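{- If $\mathcal{C}$ is a sum closed, rc-invariant permutation class, then $\mathcal{C}$ is generated by its even-size centrosymmetric elements; that is, every permutation in $\mathcal{C}$ is contained in some centrosymmetric permutation of even size belonging to $\mathcal{C}$.
   Context: A permutation of size $n$ is a bijection of $[n]$; $\pi$ contains $\sigma$ if some subsequence of $\pi$ has the same relative order as $\sigma$; a permutation class is a set of permutations closed downward under containment. For $\pi$ of size $n$, $\mathrm{rc}(\pi)(i)=n+1-\pi(n+1-i)$; $\pi$ is centrosymmetric if $\mathrm{rc}(\pi)=\pi$; $\mathcal{C}$ is rc-invariant if $\mathrm{rc}(\mathcal{C})=\mathcal{C}$. The sum $\sigma\oplus\tau$ of $\sigma$ (size $a$) and $\tau$ (size $b$) is given by $(\sigma\oplus\tau)(i)=\sigma(i)$ for $i\le a$ and $a+\tau(i-a)$ for $i>a$; $\mathcal{C}$ is sum closed if it is closed under $\oplus$. -}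

module Defs where

open import Data.Nat using (ℕ; _+_; _*_)
open import Data.Fin using (Fin; _<_)
open import Data.Fin.Properties using (+↔⊎)
open import Data.Fin.Permutation using (Permutation′; _⟨$⟩ʳ_; _∘ₚ_; reverse; flip)
open import Data.Sum.Function.Propositional using (_⊎-↔_)
open import Data.Product using (Σ; ∃; _×_)
open import Function.Bundles using (_⇔_)
open import Function.Properties.Inverse using (↔-sym; ↔-trans)
open import Relation.Binary.PropositionalEquality using (_≡_)

-- A permutation of size n is an element of Permutation′ n (Fin n ↔ Fin n),
-- applied via _⟨$⟩ʳ_.  Positions and values are 0-based.

_≼_ : ∀ {k n} → Permutation′ k → Permutation′ n → Set
_≼_ {k} {n} σ π =
  Σ (Fin k → Fin n) λ f →
    (∀ i j → i < j → f i < f j) ×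
    (∀ i j → ((σ ⟨$⟩ʳ i) < (σ ⟨$⟩ʳ j)) ⇔ ((π ⟨$⟩ʳ f i) < (π ⟨$⟩ʳ f j)))

PermSet : Set₁
PermSet = (n : ℕ) → Permutation′ n → Set

IsClass : PermSet → Set
IsClass C = ∀ {k n} (σ : Permutation′ k) (π : Permutation′ n) → σ ≼ π → C n π → C k σ

-- Reverse-complement: rc(π)(i) = n+1-π(n+1-i), i.e. opposite ∘ π ∘ opposite.
rc : ∀ {n} → Permutation′ n → Permutation′ n
rc π = reverse ∘ₚ π ∘ₚ reverse

Centrosymmetric : ∀ {n} → Permutation′ n → Set
Centrosymmetric π = ∀ i → rc π ⟨$⟩ʳ i ≡ π ⟨$⟩ʳ i

-- rc(C) = C (rc is an involution, so this is closure under rc).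
RcInvariant : PermSet → Set
RcInvariant C = ∀ n (π : Permutation′ n) → C n π → C n (rc π)

-- Direct sum σ ⊕ τ: first a positions act by σ, the last b by a + τ.
_⊕_ : ∀ {a b} → Permutation′ a → Permutation′ b → Permutation′ (a + b)
σ ⊕ τ = ↔-trans +↔⊎ (↔-trans (σ ⊎-↔ τ) (↔-sym +↔⊎))

SumClosed : PermSet → Set
SumClosed C = ∀ a b (σ : Permutation′ a) (τ : Permutation′ b) → C a σ → C b τ → C (a + b) (σ ⊕ τ)

{-# OPTIONS --safe #-}
module Submission where

-- For π in C, the sum π ⊕ rc π lies in C (rc-invariance, then sum closure),
-- has size 2n, contains π as its left summand, and is centrosymmetric since
-- rc (π ⊕ rc π) = rc (rc π) ⊕ rc π = π ⊕ rc π.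

open import Defs
open import Data.Nat using (ℕ; _*_; _+_; _∸_; suc)
open import Data.Nat.Properties using (+-∸-assoc; +-identityʳ)
open import Data.Fin using (Fin; _<_; _↑ˡ_; _↑ʳ_; splitAt; toℕ; opposite)
open import Data.Fin.Properties
  using (splitAt-↑ˡ; splitAt-↑ʳ; join-splitAt; toℕ-↑ˡ; toℕ-↑ʳ; toℕ-injective; toℕ<n;
         opposite-prop; opposite-involutive)
open import Data.Fin.Permutation using (Permutation′; _⟨$⟩ʳ_)
open import Data.Product using (Σ; _×_; _,_)
open import Data.Sum using (inj₁; inj₂)
open import Function.Bundles using (_⇔_; mk⇔; Equivalence)
open import Relation.Binary.PropositionalEquality
open ≡-Reasoning

↑-elim : ∀ {m n} (P : Fin (m + n) → Set) →
  (∀ i → P (i ↑ˡ n)) → (∀ j → P (m ↑ʳ j)) → ∀ k → P k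
↑-elim {m} {n} P left right k with splitAt m {n} k | join-splitAt m n k
... | inj₁ i | refl = left i
... | inj₂ j | refl = right j

↑ˡ-<-⇔ : ∀ {m} n (i j : Fin m) → i < j ⇔ i ↑ˡ n < j ↑ˡ n
↑ˡ-<-⇔ n i j rewrite toℕ-↑ˡ i n | toℕ-↑ˡ j n = mk⇔ (λ p → p) (λ p → p)

opposite-↑ˡ : ∀ n (i : Fin n) → opposite (i ↑ˡ n) ≡ n ↑ʳ opposite i
opposite-↑ˡ n i = toℕ-injective (begin
  toℕ (opposite (i ↑ˡ n))    ≡⟨ opposite-prop (i ↑ˡ n) ⟩
  (n + n) ∸ suc (toℕ (i ↑ˡ n)) ≡⟨ cong (λ x → (n + n) ∸ suc x) (toℕ-↑ˡ i n) ⟩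
  (n + n) ∸ suc (toℕ i)       ≡⟨ +-∸-assoc n (toℕ<n i) ⟩
  n + (n ∸ suc (toℕ i))       ≡⟨ cong (n +_) (opposite-prop i) ⟨
  n + toℕ (opposite i)        ≡⟨ toℕ-↑ʳ n (opposite i) ⟨
  toℕ (n ↑ʳ opposite i)       ∎)

opposite-↑ʳ : ∀ n (j : Fin n) → opposite (n ↑ʳ j) ≡ opposite j ↑ˡ n
opposite-↑ʳ n j = begin
  opposite (n ↑ʳ j)                     ≡⟨ cong (λ x → opposite (n ↑ʳ x)) (opposite-involutive j) ⟨
  opposite (n ↑ʳ opposite (opposite j)) ≡⟨ cong opposite (opposite-↑ˡ n (opposite j)) ⟨
  opposite (opposite (opposite j ↑ˡ n)) ≡⟨ opposite-involutive _ ⟩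
  opposite j ↑ˡ n                       ∎

⊕-↑ˡ : ∀ {a b} (σ : Permutation′ a) (τ : Permutation′ b) i →
  (σ ⊕ τ) ⟨$⟩ʳ (i ↑ˡ b) ≡ (σ ⟨$⟩ʳ i) ↑ˡ b
⊕-↑ˡ {a} {b} σ τ i rewrite splitAt-↑ˡ a i b = refl

⊕-↑ʳ : ∀ {a b} (σ : Permutation′ a) (τ : Permutation′ b) j →
  (σ ⊕ τ) ⟨$⟩ʳ (a ↑ʳ j) ≡ a ↑ʳ (τ ⟨$⟩ʳ j)
⊕-↑ʳ {a} {b} σ τ j rewrite splitAt-↑ʳ a b j = refl

⊕-containsˡ : ∀ {a b} (σ : Permutation′ a) (τ : Permutation′ b) → σ ≼ (σ ⊕ τ)
⊕-containsˡ {b = b} σ τ = (_↑ˡ b) , (λ i j → Equivalence.to (↑ˡ-<-⇔ b i j)) , order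
  where
  order : ∀ i j → (σ ⟨$⟩ʳ i) < (σ ⟨$⟩ʳ j) ⇔ ((σ ⊕ τ) ⟨$⟩ʳ (i ↑ˡ b)) < ((σ ⊕ τ) ⟨$⟩ʳ (j ↑ˡ b))
  order i j rewrite ⊕-↑ˡ σ τ i | ⊕-↑ˡ σ τ j = ↑ˡ-<-⇔ b (σ ⟨$⟩ʳ i) (σ ⟨$⟩ʳ j)

⊕-rc-centrosymmetric : ∀ {n} (π : Permutation′ n) → Centrosymmetric (π ⊕ rc π)
⊕-rc-centrosymmetric {n} π = ↑-elim _ left right
  where
  ρ = π ⊕ rc π
  left : ∀ i → rc ρ ⟨$⟩ʳ (i ↑ˡ n) ≡ ρ ⟨$⟩ʳ (i ↑ˡ n)
  left i = begin
    opposite (ρ ⟨$⟩ʳ opposite (i ↑ˡ n))  ≡⟨ cong (λ x → opposite (ρ ⟨$⟩ʳ x)) (opposite-↑ˡ n i) ⟩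
    opposite (ρ ⟨$⟩ʳ (n ↑ʳ opposite i))  ≡⟨ cong opposite (⊕-↑ʳ π (rc π) (opposite i)) ⟩
    opposite (n ↑ʳ (rc π ⟨$⟩ʳ opposite i)) ≡⟨ opposite-↑ʳ n _ ⟩
    opposite (rc π ⟨$⟩ʳ opposite i) ↑ˡ n  ≡⟨ cong (_↑ˡ n) (opposite-involutive _) ⟩
    (π ⟨$⟩ʳ opposite (opposite i)) ↑ˡ n   ≡⟨ cong (λ x → (π ⟨$⟩ʳ x) ↑ˡ n) (opposite-involutive i) ⟩
    (π ⟨$⟩ʳ i) ↑ˡ n                       ≡⟨ ⊕-↑ˡ π (rc π) i ⟨
    ρ ⟨$⟩ʳ (i ↑ˡ n)                       ∎
  right : ∀ j → rc ρ ⟨$⟩ʳ (n ↑ʳ j) ≡ ρ ⟨$⟩ʳ (n ↑ʳ j)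
  right j = begin
    opposite (ρ ⟨$⟩ʳ opposite (n ↑ʳ j))  ≡⟨ cong (λ x → opposite (ρ ⟨$⟩ʳ x)) (opposite-↑ʳ n j) ⟩
    opposite (ρ ⟨$⟩ʳ (opposite j ↑ˡ n))  ≡⟨ cong opposite (⊕-↑ˡ π (rc π) (opposite j)) ⟩
    opposite ((π ⟨$⟩ʳ opposite j) ↑ˡ n)  ≡⟨ opposite-↑ˡ n _ ⟩
    n ↑ʳ (rc π ⟨$⟩ʳ j)                   ≡⟨ ⊕-↑ʳ π (rc π) j ⟨
    ρ ⟨$⟩ʳ (n ↑ʳ j)                      ∎

proposition4p1 : (C : PermSet) → IsClass C → SumClosed C → RcInvariant C →
    ∀ n (π : Permutation′ n) → C n π →
    Σ ℕ λ m → Σ (Permutation′ (2 * m)) λ ρ →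
      Centrosymmetric ρ × C (2 * m) ρ × π ≼ ρ
proposition4p1 C _ sumClosed rcInvariant n π π∈C =
  n , subst (λ a → Σ (Permutation′ a) λ ρ → Centrosymmetric ρ × C a ρ × π ≼ ρ) n+n≡2*n
    ( π ⊕ rc π
    , ⊕-rc-centrosymmetric π
    , sumClosed n n π (rc π) π∈C (rcInvariant n π π∈C)
    , ⊕-containsˡ π (rc π))
  where
  n+n≡2*n : n + n ≡ 2 * n
  n+n≡2*n = cong (n +_) (sym (+-identityʳ n))
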